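{- Let $\lambda$ be a strict partition of length $n$ with $\lambda_1=m$, let $A\in{\cal UA}^\lambda(n)$ and let $C(A)$ be its compass point matrix. For a compass point symbol $\mathrm{XY}$ and a row index $i\in I$, let $\#\mathrm{XY}_i$ be the number of entries $\mathrm{XY}$ in row $i$ of $C(A)$. Then for each $k=1,\ldots,n$, \[ \#\mathrm{NS}_k+\#\mathrm{NW}_k+\#\mathrm{NE}_k=k-1,\qquad \#\mathrm{WE}_{\overline{k}}+\#\mathrm{NW}_{\overline{k}}+\#\mathrm{NE}_{\overline{k}}=k. \]
   Context: $U$-turn alternating sign matrices: ${\cal UA}^\lambda(n)$ is the set of $2n\times m$ matrices $A=(a_{ij})$ with rows indexed by $1,\overline{1},2,\overline{2},\ldots,n,\overline{n}$ from top to bottom and columns by $j=1,\ldots,m$, with entries in $\{1,0,-1\}$, such that: the non-zero entries alternate in sign across each row and down each column; the topmost non-zero entry in any column is $1$; the rightmost non-zero entry in every row is $1$; each row sum and each column sum is $0$ or $1$; $\mathrm{row}_k+\mathrm{row}_{\overline{k}}=1$ for $k=1,\ldots,n$; and the column sum $\mathrm{col}_j$ equals $1$ if $j=\lambda_\ell$ for some $\ell$ and $0$ otherwise. Compass point matrix $C(A)=(c_{ij})$: if $a_{ij}=1$ then $c_{ij}=\mathrm{WE}$; if $a_{ij}=-1$ then $c_{ij}=\mathrm{NS}$; if $a_{ij}=0$, let $a$ be the nearest non-zero entry above it in its column and $b$ the nearest non-zero entry to its right in its row, each deemed $-1$ if none exists; then $c_{ij}=\mathrm{NE}$ if $(a,b)=(1,-1)$,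 $\mathrm{SE}$ if $(a,b)=(-1,-1)$, $\mathrm{NW}$ if $(a,b)=(1,1)$, $\mathrm{SW}$ if $(a,b)=(-1,1)$. -}

module Defs where

open import Data.Nat using (ℕ; zero; suc; _+_; _*_; _∸_; _<_; _>_; _≟_)
open import Data.Integer as ℤ using (ℤ; +_; -[1+_])
open import Data.Bool using (Bool; true; false)
open import Data.List using (List; []; _∷_; map; filter; length; upTo; drop; sum; foldr)
open import Data.List.Membership.Propositional using (_∈_; _∉_)
open import Data.List.Relation.Unary.All using (All)
open import Data.List.Relation.Unary.Linked using (Linked)
open import Data.Product using (_×_)
open import Data.Sum using (_⊎_)
open import Data.Unit using (⊤)
open import Relation.Binary.PropositionalEquality using (_≡_)
open import Relation.Nullary.Decidable using (¬?)

StrictPartition : List ℕ → Set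
StrictPartition λs = Linked _>_ λs × All (λ x → 0 < x) λs

data Sign : Set where
  plus zer minus : Sign

toℤ : Sign → ℤ
toℤ plus  = + 1
toℤ zer   = + 0
toℤ minus = -[1+ 0 ]

-- A (2n × m) matrix, given as a function of (0-based) row and column
-- indices. Row index 2(k-1) is row k, row index 2(k-1)+1 is row k̄
-- (top-to-bottom order 1, 1̄, 2, 2̄, …, n, n̄). Column index j (0-based)
-- is column j+1. Entries outside the range [0,2n) × [0,m) are ignored.
Matrix : Set
Matrix = ℕ → ℕ → Sign

isNonZero : Sign → Bool
isNonZero zer = false
isNonZero _   = true

data IsNZ : Sign → Set where
  nzp : IsNZ plus
  nzm : IsNZ minus

open import Relation.Nullary using (Dec; yes; no)

isNZ? : (s : Sign) → Dec (IsNZ s)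
isNZ? plus  = yes nzp
isNZ? zer   = no (λ ())
isNZ? minus = yes nzm

nonzeros : List Sign → List Sign
nonzeros = filter isNZ?

rowList : ℕ → Matrix → ℕ → List Sign
rowList m A r = map (A r) (upTo m)

colList : ℕ → Matrix → ℕ → List Sign
colList n A j = map (λ r → A r j) (upTo (2 * n))

Alternating : List Sign → Set
Alternating [] = ⊤
Alternating (x ∷ []) = ⊤
Alternating (x ∷ y ∷ xs) = (toℤ y ≡ ℤ.- toℤ x) × Alternating (y ∷ xs)

headOr : Sign → List Sign → Sign
headOr d [] = d
headOr d (x ∷ _) = x

lastOr : Sign → List Sign → Sign
lastOr d [] = d
lastOr d (x ∷ xs) = lastOr x xs

TopIsOne : List Sign → Set
TopIsOne [] = ⊤
TopIsOne (x ∷ _) = x ≡ plus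

LastIsOne : List Sign → Set
LastIsOne [] = ⊤
LastIsOne (x ∷ []) = x ≡ plus
LastIsOne (x ∷ y ∷ xs) = LastIsOne (y ∷ xs)

sumℤ : List Sign → ℤ
sumℤ xs = foldr ℤ._+_ (+ 0) (map toℤ xs)

rowSum : ℕ → Matrix → ℕ → ℤ
rowSum m A r = sumℤ (rowList m A r)

colSum : ℕ → Matrix → ℕ → ℤ
colSum n A j = sumℤ (colList n A j)

ZeroOrOne : ℤ → Set
ZeroOrOne z = (z ≡ + 0) ⊎ (z ≡ + 1)

rowU : ℕ → ℕ
rowU k = 2 * (k ∸ 1)

rowB : ℕ → ℕ
rowB k = suc (2 * (k ∸ 1))

record IsUASM (n m : ℕ) (λs : List ℕ) (A : Matrix) : Set where
  field
    rowAlt   : ∀ r → r < 2 * n → Alternating (nonzeros (rowList m A r))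
    colAlt   : ∀ j → j < m → Alternating (nonzeros (colList n A j))
    colTop   : ∀ j → j < m → TopIsOne (nonzeros (colList n A j))
    rowRight : ∀ r → r < 2 * n → LastIsOne (nonzeros (rowList m A r))
    rowSum01 : ∀ r → r < 2 * n → ZeroOrOne (rowSum m A r)
    colSum01 : ∀ j → j < m → ZeroOrOne (colSum n A j)
    rowPair  : ∀ k → 1 Data.Nat.≤ k → k Data.Nat.≤ n →
               rowSum m A (rowU k) ℤ.+ rowSum m A (rowB k) ≡ + 1
    colIn    : ∀ j → j < m → suc j ∈ λs → colSum n A j ≡ + 1
    colOut   : ∀ j → j < m → suc j ∉ λs → colSum n A j ≡ + 0

data Compass : Set where
  NE SE NW SW NS WE : Compass

code : Compass → ℕ
code NE = 0
code SE = 1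
code NW = 2
code SW = 3
code NS = 4
code WE = 5

-- nearest non-zero entry above (i,j) in column j, -1 if none
above : Matrix → ℕ → ℕ → Sign
above A i j = lastOr minus (nonzeros (map (λ r → A r j) (upTo i)))

-- nearest non-zero entry to the right of (i,j) in row i, -1 if none
right : ℕ → Matrix → ℕ → ℕ → Sign
right m A i j = headOr minus (nonzeros (map (A i) (drop (suc j) (upTo m))))

fromAB : Sign → Sign → Compass
fromAB plus  minus = NE
fromAB minus minus = SE
fromAB plus  plus  = NW
fromAB minus plus  = SW
fromAB _     _     = SE   -- unreachable: a, b are always non-zero

compass : ℕ → Matrix → ℕ → ℕ → Compass
compass m A i j with A i j
... | plus  = WE
... | minus = NS
... | zer   = fromAB (above A i j) (right m A i j)

count : ℕ → Matrix → ℕ → Compass → ℕ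
count m A i X = length (filter (λ j → code (compass m A i j) ≟ code X) (upTo m))

-- Let P j i be the sum of the entries of column j in the rows above row i.
-- Because a column alternates and starts with 1, P j i is 1 or 0 according as
-- the nearest non-zero entry above (i, j) is 1 or -1 (none counting as -1).
-- Going through the six compass points shows that (i, j) is NS, NW or NE
-- exactly when P j i = 1, and WE, NW or NE exactly when P j (i + 1) = 1.  So
-- the two counts in a row are the totals of the matrix above that row and
-- down to that row, and since rows k and k̄ together sum to 1, these totals
-- are k - 1 above row k and k down to row k̄.  Only the column conditions
-- (alternation, topmost entry 1) and the row pair sums are needed.
module Submission where

open import Defs
open import Data.Nat using (ℕ; _+_; _∸_; _≤_)
open import Data.List using (List; _∷_; length)
open import Relation.Binary.PropositionalEquality using (_≡_)
open import Data.Product using (_×_)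

open import Data.Bool using (true; false; if_then_else_)
open import Data.Nat
  using (zero; suc; _<_; _*_; _≤′_; ≤′-refl; ≤′-step; s≤s; z≤n; _≟_)
import Data.Nat.Properties as ℕ
open import Data.Integer as ℤ using (ℤ; +_; -[1+_])
import Data.Integer.Properties as ℤ
open import Algebra.Properties.CommutativeSemigroup ℤ.+-commutativeSemigroup using (interchange)
open import Data.List using ([]; _++_; _∷ʳ_; map; filter; foldr; upTo; drop)
open import Data.List.Properties
  using (map-++; map-∘; map-cong-local; filter-++; upTo-∷ʳ; ++-assoc; ++-identityʳ)
open import Data.List.Relation.Unary.All as All using (All)
open import Data.List.Membership.Propositional.Properties using (∈-upTo⁻)
open import Data.Product using (_,_; ∃; proj₁; proj₂)
open import Data.Unit using (tt)
open import Function using (_∘_)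
open import Relation.Nullary using (does)
open import Relation.Unary using (Decidable)
open import Relation.Binary.PropositionalEquality
  using (refl; sym; trans; cong; cong₂; subst; module ≡-Reasoning)

open ≡-Reasoning

Σ : {X : Set} → (X → ℤ) → List X → ℤ
Σ f xs = foldr ℤ._+_ (+ 0) (map f xs)

Σ-++ : {X : Set} (f : X → ℤ) (xs ys : List X) → Σ f (xs ++ ys) ≡ Σ f xs ℤ.+ Σ f ys
Σ-++ f []       ys = sym (ℤ.+-identityˡ _)
Σ-++ f (x ∷ xs) ys = trans (cong (ℤ._+_ (f x)) (Σ-++ f xs ys)) (sym (ℤ.+-assoc (f x) _ _))

Σ-+ : {X : Set} (f g : X → ℤ) (xs : List X) →
      Σ (λ x → f x ℤ.+ g x) xs ≡ Σ f xs ℤ.+ Σ g xs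
Σ-+ f g []       = refl
Σ-+ f g (x ∷ xs) =
  trans (cong (ℤ._+_ (f x ℤ.+ g x)) (Σ-+ f g xs)) (interchange (f x) (g x) _ _)

Σ-zero : {X : Set} (xs : List X) → Σ (λ _ → + 0) xs ≡ + 0
Σ-zero []       = refl
Σ-zero (x ∷ xs) = trans (ℤ.+-identityˡ _) (Σ-zero xs)

Σ-cong : {X : Set} {f g : X → ℤ} {xs : List X} →
         All (λ x → f x ≡ g x) xs → Σ f xs ≡ Σ g xs
Σ-cong eqs = cong (foldr ℤ._+_ (+ 0)) (map-cong-local eqs)

Σ-map : {X Y : Set} (f : Y → ℤ) (g : X → Y) (xs : List X) →
        Σ f (map g xs) ≡ Σ (f ∘ g) xs
Σ-map f g xs = cong (foldr ℤ._+_ (+ 0)) (sym (map-∘ xs))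

length-filter-Σ : {X : Set} {P : X → Set} (P? : Decidable P) (xs : List X) →
                  + length (filter P? xs) ≡ Σ (λ x → if does (P? x) then + 1 else + 0) xs
length-filter-Σ P? []       = refl
length-filter-Σ P? (x ∷ xs) with does (P? x)
... | true  = trans (ℤ.pos-+ 1 _) (cong (ℤ._+_ (+ 1)) (length-filter-Σ P? xs))
... | false = trans (length-filter-Σ P? xs) (sym (ℤ.+-identityˡ _))

upTo-prefix : ∀ {i N} → i ≤′ N → ∃ λ rest → upTo N ≡ upTo i ++ rest
upTo-prefix {i} ≤′-refl = [] , sym (++-identityʳ (upTo i))
upTo-prefix {i} (≤′-step {N} i≤′N) with upTo-prefix i≤′N
... | rest , upTo-N = rest ∷ʳ N , (begin
  upTo (suc N)          ≡⟨ sym (upTo-∷ʳ N) ⟩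
  upTo N ∷ʳ N           ≡⟨ cong (_∷ʳ N) upTo-N ⟩
  (upTo i ++ rest) ∷ʳ N ≡⟨ ++-assoc (upTo i) rest (N ∷ []) ⟩
  upTo i ++ rest ∷ʳ N   ∎)

Alternating-++⁻ˡ : ∀ xs ys → Alternating (xs ++ ys) → Alternating xs
Alternating-++⁻ˡ []           ys _         = tt
Alternating-++⁻ˡ (x ∷ [])     ys _         = tt
Alternating-++⁻ˡ (x ∷ y ∷ xs) ys (eq , alt) = eq , Alternating-++⁻ˡ (y ∷ xs) ys alt

TopIsOne-++⁻ˡ : ∀ xs ys → TopIsOne (xs ++ ys) → TopIsOne xs
TopIsOne-++⁻ˡ []       ys _   = tt
TopIsOne-++⁻ˡ (x ∷ xs) ys top = top

sumℤ-nonzeros : ∀ xs → sumℤ (nonzeros xs) ≡ sumℤ xs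
sumℤ-nonzeros []           = refl
sumℤ-nonzeros (plus ∷ xs)  = cong (ℤ._+_ (+ 1)) (sumℤ-nonzeros xs)
sumℤ-nonzeros (zer ∷ xs)   = trans (sumℤ-nonzeros xs) (sym (ℤ.+-identityˡ _))
sumℤ-nonzeros (minus ∷ xs) = cong (ℤ._+_ -[1+ 0 ]) (sumℤ-nonzeros xs)

headOr-nonzeros : ∀ xs → IsNZ (headOr minus (nonzeros xs))
headOr-nonzeros []           = nzm
headOr-nonzeros (plus ∷ xs)  = nzp
headOr-nonzeros (zer ∷ xs)   = headOr-nonzeros xs
headOr-nonzeros (minus ∷ xs) = nzm

data LastWithSum : Sign → ℤ → Set where
  last-plus  : LastWithSum plus  (+ 1)
  last-minus : LastWithSum minus (+ 0)

alternating-lastWithSum : ∀ xs → Alternating xs → TopIsOne xs →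
                          LastWithSum (lastOr minus xs) (sumℤ xs)
alternating-lastWithSum []                          _             _    = last-minus
alternating-lastWithSum (plus ∷ [])                 _             refl = last-plus
alternating-lastWithSum (plus ∷ minus ∷ [])         _             refl = last-minus
alternating-lastWithSum (plus ∷ minus ∷ rest@(plus ∷ _)) (_ , _ , alt) refl =
  subst (LastWithSum (lastOr minus rest)) (sym cancel) (alternating-lastWithSum rest alt refl)
  where
  cancel : + 1 ℤ.+ (-[1+ 0 ] ℤ.+ sumℤ rest) ≡ sumℤ rest
  cancel = trans (sym (ℤ.+-assoc (+ 1) -[1+ 0 ] (sumℤ rest))) (ℤ.+-identityˡ _)
alternating-lastWithSum (plus ∷ plus ∷ _)           (() , _)      refl
alternating-lastWithSum (plus ∷ zer ∷ _)            (() , _)      refl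
alternating-lastWithSum (plus ∷ minus ∷ minus ∷ _)  (_ , () , _)  refl
alternating-lastWithSum (plus ∷ minus ∷ zer ∷ _)    (_ , () , _)  refl
alternating-lastWithSum (zer ∷ _)                   _             ()
alternating-lastWithSum (minus ∷ _)                 _             ()

compassOf : Sign → Sign → Sign → Compass
compassOf plus  _ _ = WE
compassOf minus _ _ = NS
compassOf zer   a b = fromAB a b

compass-≡-compassOf : ∀ m A i j →
                      compass m A i j ≡ compassOf (A i j) (above A i j) (right m A i j)
compass-≡-compassOf m A i j with A i j
... | plus  = refl
... | minus = refl
... | zer   = refl

δ : Compass → Compass → ℤ
δ X c = if does (code c ≟ code X) then + 1 else + 0

unbarredWeight barredWeight : Compass → ℤ
unbarredWeight c = δ NS c ℤ.+ δ NW c ℤ.+ δ NE c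
barredWeight   c = δ WE c ℤ.+ δ NW c ℤ.+ δ NE c

compassOf-weights : ∀ s {a b a′ p q} → IsNZ b → LastWithSum a p → LastWithSum a′ q →
                    q ≡ p ℤ.+ toℤ s →
                    unbarredWeight (compassOf s a b) ≡ p × barredWeight (compassOf s a b) ≡ q
compassOf-weights plus  _   last-minus last-plus  refl = refl , refl
compassOf-weights minus _   last-plus  last-minus refl = refl , refl
compassOf-weights zer   nzp last-plus  last-plus  refl = refl , refl
compassOf-weights zer   nzm last-plus  last-plus  refl = refl , refl
compassOf-weights zer   nzp last-minus last-minus refl = refl , refl
compassOf-weights zer   nzm last-minus last-minus refl = refl , refl
compassOf-weights plus  _   last-plus  last-plus  ()
compassOf-weights plus  _   last-plus  last-minus ()
compassOf-weights plus  _   last-minus last-minus ()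
compassOf-weights minus _   last-plus  last-plus  ()
compassOf-weights minus _   last-minus last-plus  ()
compassOf-weights minus _   last-minus last-minus ()
compassOf-weights zer   _   last-plus  last-minus ()
compassOf-weights zer   _   last-minus last-plus  ()

count₃-Σ : ∀ m A i X Y Z →
           + (count m A i X + count m A i Y + count m A i Z) ≡
           Σ (λ j → let c = compass m A i j in δ X c ℤ.+ δ Y c ℤ.+ δ Z c) (upTo m)
count₃-Σ m A i X Y Z = begin
  + (count m A i X + count m A i Y + count m A i Z)
    ≡⟨ trans (ℤ.pos-+ _ (count m A i Z))
             (cong (ℤ._+ + count m A i Z) (ℤ.pos-+ (count m A i X) _)) ⟩
  + count m A i X ℤ.+ + count m A i Y ℤ.+ + count m A i Z
    ≡⟨ cong₂ ℤ._+_ (cong₂ ℤ._+_ (counted X) (counted Y)) (counted Z) ⟩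
  Σ (δ X ∘ c) (upTo m) ℤ.+ Σ (δ Y ∘ c) (upTo m) ℤ.+ Σ (δ Z ∘ c) (upTo m)
    ≡⟨ cong (ℤ._+ Σ (δ Z ∘ c) (upTo m)) (sym (Σ-+ (δ X ∘ c) (δ Y ∘ c) (upTo m))) ⟩
  Σ (λ j → δ X (c j) ℤ.+ δ Y (c j)) (upTo m) ℤ.+ Σ (δ Z ∘ c) (upTo m)
    ≡⟨ sym (Σ-+ _ (δ Z ∘ c) (upTo m)) ⟩
  Σ (λ j → δ X (c j) ℤ.+ δ Y (c j) ℤ.+ δ Z (c j)) (upTo m) ∎
  where
  c : ℕ → Compass
  c = compass m A i
  counted : ∀ X → + count m A i X ≡ Σ (δ X ∘ c) (upTo m)
  counted X = length-filter-Σ (λ j → code (c j) ≟ code X) (upTo m)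

module PrefixSums (m : ℕ) (A : Matrix) where

  colPrefix : ℕ → ℕ → List Sign
  colPrefix j i = map (λ r → A r j) (upTo i)

  prefixSum : ℕ → ℕ → ℤ
  prefixSum j i = sumℤ (colPrefix j i)

  blockSum : ℕ → ℤ
  blockSum i = Σ (λ j → prefixSum j i) (upTo m)

  prefixSum-suc : ∀ j i → prefixSum j (suc i) ≡ prefixSum j i ℤ.+ toℤ (A i j)
  prefixSum-suc j i = begin
    sumℤ (map f (upTo (suc i)))            ≡⟨ cong (sumℤ ∘ map f) (sym (upTo-∷ʳ i)) ⟩
    sumℤ (map f (upTo i ++ i ∷ []))        ≡⟨ cong sumℤ (map-++ f (upTo i) (i ∷ [])) ⟩
    sumℤ (colPrefix j i ++ f i ∷ [])       ≡⟨ Σ-++ toℤ (colPrefix j i) (f i ∷ []) ⟩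
    prefixSum j i ℤ.+ (toℤ (f i) ℤ.+ + 0)  ≡⟨ cong (ℤ._+_ (prefixSum j i)) (ℤ.+-identityʳ _) ⟩
    prefixSum j i ℤ.+ toℤ (A i j)          ∎
    where
    f : ℕ → Sign
    f r = A r j

  blockSum-zero : blockSum 0 ≡ + 0
  blockSum-zero = Σ-zero (upTo m)

  blockSum-suc : ∀ i → blockSum (suc i) ≡ blockSum i ℤ.+ rowSum m A i
  blockSum-suc i = begin
    blockSum (suc i)
      ≡⟨ Σ-cong (All.universal (λ j → prefixSum-suc j i) (upTo m)) ⟩
    Σ (λ j → prefixSum j i ℤ.+ toℤ (A i j)) (upTo m)
      ≡⟨ Σ-+ (λ j → prefixSum j i) (toℤ ∘ A i) (upTo m) ⟩
    blockSum i ℤ.+ Σ (toℤ ∘ A i) (upTo m)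
      ≡⟨ cong (ℤ._+_ (blockSum i)) (sym (Σ-map toℤ (A i) (upTo m))) ⟩
    blockSum i ℤ.+ rowSum m A i
      ∎

module _ {n m : ℕ} {λs : List ℕ} {A : Matrix} (U : IsUASM n m λs A) where
  open IsUASM U
  open PrefixSums m A

  lastWithSum-above : ∀ {i j} → i ≤ 2 * n → j < m →
                      LastWithSum (above A i j) (prefixSum j i)
  lastWithSum-above {i} {j} i≤2n j<m with upTo-prefix (ℕ.≤⇒≤′ i≤2n)
  ... | rest , upTo-2n =
    subst (LastWithSum (above A i j)) (sumℤ-nonzeros (colPrefix j i))
      (alternating-lastWithSum (nonzeros (colPrefix j i))
        (Alternating-++⁻ˡ _ _ (subst Alternating split (colAlt j j<m)))
        (TopIsOne-++⁻ˡ _ _ (subst TopIsOne split (colTop j j<m))))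
    where
    f : ℕ → Sign
    f r = A r j
    split : nonzeros (colList n A j) ≡ nonzeros (colPrefix j i) ++ nonzeros (map f rest)
    split = begin
      nonzeros (map f (upTo (2 * n)))
        ≡⟨ cong (nonzeros ∘ map f) upTo-2n ⟩
      nonzeros (map f (upTo i ++ rest))
        ≡⟨ cong nonzeros (map-++ f (upTo i) rest) ⟩
      nonzeros (colPrefix j i ++ map f rest)
        ≡⟨ filter-++ isNZ? (colPrefix j i) (map f rest) ⟩
      nonzeros (colPrefix j i) ++ nonzeros (map f rest)
        ∎

  compass-weights : ∀ {i j} → i < 2 * n → j < m →
                    unbarredWeight (compass m A i j) ≡ prefixSum j i ×
                    barredWeight (compass m A i j) ≡ prefixSum j (suc i)
  compass-weights {i} {j} i<2n j<m rewrite compass-≡-compassOf m A i j =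
    compassOf-weights (A i j) (headOr-nonzeros (map (A i) (drop (suc j) (upTo m))))
      (lastWithSum-above (ℕ.<⇒≤ i<2n) j<m) (lastWithSum-above i<2n j<m) (prefixSum-suc j i)

  blockSum-even : ∀ k → k ≤ n → blockSum (2 * k) ≡ + k
  blockSum-even zero    _     = blockSum-zero
  blockSum-even (suc k) 1+k≤n = begin
    blockSum (2 * suc k)
      ≡⟨ cong blockSum (ℕ.*-suc 2 k) ⟩
    blockSum (suc (suc (2 * k)))
      ≡⟨ blockSum-suc (suc (2 * k)) ⟩
    blockSum (suc (2 * k)) ℤ.+ rowSum m A (rowB (suc k))
      ≡⟨ cong (ℤ._+ rowSum m A (rowB (suc k))) (blockSum-suc (2 * k)) ⟩
    blockSum (2 * k) ℤ.+ rowSum m A (rowU (suc k)) ℤ.+ rowSum m A (rowB (suc k))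
      ≡⟨ ℤ.+-assoc (blockSum (2 * k)) _ _ ⟩
    blockSum (2 * k) ℤ.+ (rowSum m A (rowU (suc k)) ℤ.+ rowSum m A (rowB (suc k)))
      ≡⟨ cong₂ ℤ._+_ (blockSum-even k (ℕ.<⇒≤ 1+k≤n)) (rowPair (suc k) (s≤s z≤n) 1+k≤n) ⟩
    + k ℤ.+ + 1
      ≡⟨ sym (ℤ.pos-+ k 1) ⟩
    + (k + 1)
      ≡⟨ cong +_ (ℕ.+-comm k 1) ⟩
    + suc k
      ∎

  unbarred-count : ∀ {i} → i < 2 * n →
                   + (count m A i NS + count m A i NW + count m A i NE) ≡ blockSum i
  unbarred-count {i} i<2n = trans (count₃-Σ m A i NS NW NE)
    (Σ-cong (All.tabulate (λ j∈ → proj₁ (compass-weights i<2n (∈-upTo⁻ j∈)))))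

  barred-count : ∀ {i} → i < 2 * n →
                 + (count m A i WE + count m A i NW + count m A i NE) ≡ blockSum (suc i)
  barred-count {i} i<2n = trans (count₃-Σ m A i WE NW NE)
    (Σ-cong (All.tabulate (λ j∈ → proj₂ (compass-weights i<2n (∈-upTo⁻ j∈)))))

lemma7 : (m : ℕ) (μ : List ℕ) → StrictPartition (m ∷ μ) →
         (A : Matrix) → IsUASM (length (m ∷ μ)) m (m ∷ μ) A →
         (k : ℕ) → 1 ≤ k → k ≤ length (m ∷ μ) →
         (count m A (rowU k) NS + count m A (rowU k) NW + count m A (rowU k) NE ≡ k ∸ 1)
         × (count m A (rowB k) WE + count m A (rowB k) NW + count m A (rowB k) NE ≡ k)
lemma7 m μ _ A U (suc k) _ 1+k≤n =
  ℤ.+-injective (trans (unbarred-count U (ℕ.<⇒≤ rowB<2n))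
                       (blockSum-even U k (ℕ.<⇒≤ 1+k≤n))) ,
  ℤ.+-injective (begin
    + (count m A (rowB (suc k)) WE + count m A (rowB (suc k)) NW + count m A (rowB (suc k)) NE)
      ≡⟨ barred-count U rowB<2n ⟩
    blockSum (suc (suc (2 * k)))  ≡⟨ cong blockSum (sym (ℕ.*-suc 2 k)) ⟩
    blockSum (2 * suc k)          ≡⟨ blockSum-even U (suc k) 1+k≤n ⟩
    + suc k                       ∎)
  where
  open PrefixSums m A
  rowB<2n : rowB (suc k) < 2 * length (m ∷ μ)
  rowB<2n = subst (_≤ 2 * length (m ∷ μ)) (ℕ.*-suc 2 k) (ℕ.*-monoʳ-≤ 2 1+k≤n)
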